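{- Suppose $a,b$ are positive integers with $a \leq b$ and $s$ is a nonnegative integer. If $a \leq s+1$, then $\tau_s(a,b) = 0$. Moreover, if $a=s+2$, then $\tau_s(a,b)=0$ if and only if $b < (s+2)^{s+2}$.
   Context: All graphs are finite and simple. For graphs $G,H$ on disjoint vertex sets, the join $G \vee H$ is the graph consisting of $G$, $H$, and all edges joining a vertex of $G$ to a vertex of $H$; $K_n$ is the complete graph on $n$ vertices, and $K_0 \vee G$ is understood as $G$. $K_{a,b}$ is the complete bipartite graph with partite sets of sizes $a$ and $b$. $\chi$ denotes chromatic number and $\chi_\ell$ list chromatic number. For a nonnegative integer $s$ and positive integers $a,b$, $\tau_s(a,b)$ denotes the smallest nonnegative integer $n$ such that $\chi_\ell(K_n \vee K_{a,b}) - \chi(K_n \vee K_{a,b}) \leq s$. -}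

module Defs where

open import Level using (0ℓ)
open import Data.Nat using (ℕ; _≤_; _∸_; _+_)
open import Data.Fin using (Fin; splitAt)
open import Data.Sum using (_⊎_; inj₁; inj₂)
open import Data.Unit using (⊤)
open import Data.Empty using (⊥)
open import Data.Product using (_×_; ∃; proj₁)
open import Data.List using (List; length)
open import Data.List.Membership.Propositional using (_∈_)
open import Data.List.Relation.Unary.Unique.Propositional using (Unique)
open import Relation.Binary.PropositionalEquality using (_≡_; _≢_)
open import Relation.Nullary using (¬_)

record Graph : Set₁ where
  field
    V   : ℕ
    Adj : Fin V → Fin V → Set

open Graph public

K : ℕ → Graph
K n = record { V = n ; Adj = λ i j → i ≢ j }

E : ℕ → Graph
E n = record { V = n ; Adj = λ _ _ → ⊥ }

joinAdj : ∀ {m n} → (Fin m → Fin m → Set) → (Fin n → Fin n → Set)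
        → Fin m ⊎ Fin n → Fin m ⊎ Fin n → Set
joinAdj A B (inj₁ i) (inj₁ j) = A i j
joinAdj A B (inj₂ i) (inj₂ j) = B i j
joinAdj A B (inj₁ _) (inj₂ _) = ⊤
joinAdj A B (inj₂ _) (inj₁ _) = ⊤

_∨G_ : Graph → Graph → Graph
G ∨G H = record
  { V   = V G + V H
  ; Adj = λ x y → joinAdj (Adj G) (Adj H) (splitAt (V G) x) (splitAt (V G) y) }

Kbip : ℕ → ℕ → Graph
Kbip a b = E a ∨G E b

ProperColouring : (G : Graph) {C : Set} → (Fin (V G) → C) → Set
ProperColouring G c = ∀ x y → Adj G x y → ¬ (c x ≡ c y)

Colourable : Graph → ℕ → Set
Colourable G k = ∃ λ (c : Fin (V G) → Fin k) → ProperColouring G c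

IsChromaticNumber : Graph → ℕ → Set
IsChromaticNumber G k = Colourable G k × (∀ j → Colourable G j → k ≤ j)

ListAssignment : Graph → ℕ → Set
ListAssignment G k = ∃ λ (L : Fin (V G) → List ℕ) → ∀ x → Unique (L x) × length (L x) ≡ k

Choosable : Graph → ℕ → Set
Choosable G k = ∀ (LA : ListAssignment G k) →
  ∃ λ (c : Fin (V G) → ℕ) → ProperColouring G c × (∀ x → c x ∈ proj₁ LA x)

IsListChromaticNumber : Graph → ℕ → Set
IsListChromaticNumber G k = Choosable G k × (∀ j → Choosable G j → k ≤ j)

GapAtMost : ℕ → ℕ → ℕ → ℕ → Set
GapAtMost s n a b = ∀ χ χℓ → IsChromaticNumber G χ → IsListChromaticNumber G χℓ → χℓ ∸ χ ≤ s
  where G = K n ∨G Kbip a b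

IsTau : ℕ → ℕ → ℕ → ℕ → Set
IsTau s a b t = GapAtMost s t a b × (∀ m → GapAtMost s m a b → t ≤ m)

-- Since χ(K_{a,b}) = 2, τ_s(a,b) = 0 says that K_{a,b} is k-choosable for k = s + 2. Given k-lists, colour
-- the a-side from its lists first; a b-vertex is then stuck only if its list consists of colours used there.
-- If a < k, fewer than k colours are used, so no b-vertex is stuck. Let a = k. If b ≥ kᵏ, give the a-side
-- disjoint lists and list all kᵏ transversals of them on the b-side: every colouring of the a-side is one of
-- these transversals and sticks a b-vertex, so χ_ℓ = k + 1 and the gap is s + 1. If b < kᵏ and every
-- transversal got stuck somewhere, two distinct transversals would, by pigeonhole, stick the same b-vertex;
-- both then have the k colours of its list as values, so one entry where they differ can be swapped to give a
-- colouring of the a-side with only k - 1 colours.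
{-# OPTIONS --safe #-}
module Submission where

open import Defs
open import Level using (Level)
open import Data.Nat using (ℕ; zero; suc; _≤_; _<_; _+_; _^_; _⊓_; z≤n; s≤s; _≤?_; _<?_)
import Data.Nat.Properties as ℕ
open import Data.Nat.Properties
  using (≤-trans; ≤-reflexive; ≤-refl; ∸-mono; ≰⇒>; +-comm; m≤n⇒m⊓n≡m; n≮n)
open import Data.Fin
  using (Fin; zero; suc; splitAt; join; _↑ˡ_; _↑ʳ_; punchIn; punchOut; toℕ; finToFun; funToFin; fromℕ<;
         inject≤; combine)
import Data.Fin.Properties as Fin
open import Data.Fin.Properties
  using (punchIn-punchOut; splitAt-↑ˡ; splitAt-↑ʳ; join-splitAt; funToFin-finToFin; finToFun-funToFin;
         ¬∀⟶∃¬; pigeonhole; <⇒≢; any?; all?; combine-injectiveˡ; combine-injectiveʳ; toℕ-injective; toℕ-fromℕ<;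
         toℕ-inject≤; toℕ<n)
open import Data.Sum using (inj₁; inj₂; [_,_]; [_,_]′)
open import Data.Product using (Σ; ∃; _×_; _,_; proj₁; proj₂)
open import Data.List using (List; _∷_; length; map; allFin; take; lookup)
open import Data.List.Properties using (length-map; length-tabulate; length-take)
open import Data.List.Membership.Propositional using (_∈_; find)
open import Data.List.Membership.Propositional.Properties using (∈-map⁻; ∈-lookup)
import Data.List.Membership.DecPropositional as DecMembership
open import Data.List.Relation.Unary.Any as Any using (Any)
open import Data.List.Relation.Unary.All as All using (All)
open import Data.List.Relation.Unary.All.Properties using (¬All⇒Any¬; ¬Any⇒All¬)
open import Data.List.Relation.Unary.AllPairs using (_∷_)
open import Data.List.Relation.Unary.Unique.Propositional using (Unique)
import Data.List.Relation.Unary.Unique.Propositional.Properties as Unique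
import Data.List.Relation.Binary.Sublist.Propositional as Sublist
open import Data.List.Relation.Binary.Sublist.Propositional.Properties using (take-⊆)
open import Relation.Binary.PropositionalEquality hiding ([_])
open import Relation.Binary.Definitions using (DecidableEquality)
open import Relation.Nullary using (¬_; Dec; yes; no; ¬?)
open import Relation.Nullary.Decidable using (decidable-stable)
open import Data.Empty using (⊥; ⊥-elim)
open import Data.Unit using (tt)
open import Function using (_∘_; id)
open import Function.Bundles using (_⇔_; mk⇔)

private
  variable
    ℓ : Level
    k m n p q s : ℕ

funToFin-cong : {f g : Fin m → Fin n} → (∀ i → f i ≡ g i) → funToFin f ≡ funToFin g
funToFin-cong {zero}  _   = refl
funToFin-cong {suc m} f≗g = cong₂ combine (f≗g zero) (funToFin-cong (f≗g ∘ suc))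

finToFun-≢ : {e₁ e₂ : Fin (m ^ n)} → e₁ ≢ e₂ → ∃ λ i → finToFun e₁ i ≢ finToFun e₂ i
finToFun-≢ {m} {n} {e₁} {e₂} e₁≢e₂ =
  ¬∀⟶∃¬ n _ (λ i → finToFun e₁ i Fin.≟ finToFun e₂ i) λ same → e₁≢e₂ (begin
    e₁                              ≡⟨ funToFin-finToFin {n} {m} e₁ ⟨
    funToFin (finToFun {m} {n} e₁)  ≡⟨ funToFin-cong same ⟩
    funToFin (finToFun {m} {n} e₂)  ≡⟨ funToFin-finToFin {n} {m} e₂ ⟩
    e₂                              ∎)
  where open ≡-Reasoning

module _ {A : Set ℓ} where

  infix 4 _∈Im_ _∉Im_

  _∈Im_ : A → (Fin m → A) → Set ℓ
  x ∈Im h = ∃ λ t → h t ≡ x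

  _∉Im_ : A → (Fin m → A) → Set ℓ
  x ∉Im h = ¬ x ∈Im h

  ∈Im-punchIn : {h : Fin (suc n) → A} {x : A} (i : Fin (suc n)) (x∈ : x ∈Im h) →
                i ≢ proj₁ x∈ → x ∈Im (h ∘ punchIn i)
  ∈Im-punchIn {h = h} i (t , ht≡x) i≢t = punchOut i≢t , trans (cong h (punchIn-punchOut i≢t)) ht≡x

  lookup-injective : {xs : List A} → Unique xs → {p q : Fin (length xs)} →
                     lookup xs p ≡ lookup xs q → p ≡ q
  lookup-injective {xs = _ ∷ _} _         {zero}  {zero}  _  = refl
  lookup-injective {xs = _ ∷ _} (x∉ ∷ _)  {zero}  {suc q} eq = ⊥-elim (All.lookup x∉ (∈-lookup q) eq)
  lookup-injective {xs = _ ∷ _} (x∉ ∷ _)  {suc p} {zero}  eq = ⊥-elim (All.lookup x∉ (∈-lookup p) (sym eq))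
  lookup-injective {xs = _ ∷ _} (_ ∷ uxs) {suc p} {suc q} eq = cong suc (lookup-injective uxs eq)

  entry : (xs : List A) → length xs ≡ n → Fin n → A
  entry xs refl = lookup xs

  entry-∈ : (xs : List A) (len : length xs ≡ n) (d : Fin n) → entry xs len d ∈ xs
  entry-∈ xs refl = ∈-lookup

  entry-injective : {xs : List A} → Unique xs → (len : length xs ≡ n) → {d d′ : Fin n} →
                    entry xs len d ≡ entry xs len d′ → d ≡ d′
  entry-injective uxs refl = lookup-injective uxs

  ¬covered-by-fewer : {xs : List A} → Unique xs → m < length xs → (h : Fin m → A) → ¬ All (_∈Im h) xs
  ¬covered-by-fewer {xs = xs} uxs m<len h cov =
    let i , j , i<j , same = pigeonhole m<len (proj₁ ∘ preimage)
    in <⇒≢ i<j (lookup-injective uxs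
         (trans (sym (proj₂ (preimage i))) (trans (cong h same) (proj₂ (preimage j)))))
    where
    preimage : ∀ p → lookup xs p ∈Im h
    preimage p = All.lookup cov (∈-lookup p)

  Uniform : ℕ → (Fin n → List A) → Set ℓ
  Uniform k L = ∀ x → Unique (L x) × length (L x) ≡ k

  BipartiteListColouring : (Fin p → List A) → (Fin q → List A) → Set ℓ
  BipartiteListColouring {p} {q} LA LB =
    Σ (Fin p → A) λ f → Σ (Fin q → A) λ g →
      (∀ i → f i ∈ LA i) × (∀ j → g j ∈ LB j) × (∀ i j → f i ≢ g j)

  ChoiceWithin : (Fin p → List A) → (Fin m → A) → Set ℓ
  ChoiceWithin {p} L h = Σ (Fin p → A) λ f → (∀ i → f i ∈ L i) × (∀ i → f i ∈Im h)

  colouring-avoiding : {LA : Fin p → List A} {LB : Fin q → List A} {f : Fin p → A} →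
                       (∀ i → f i ∈ LA i) → (∀ j → Any (_∉Im f) (LB j)) → BipartiteListColouring LA LB
  colouring-avoiding {q = q} {LB = LB} {f} f∈ free = f , g , f∈ , g∈ , λ i j fi≡gj → g∉ j (i , fi≡gj)
    where
    free-colour : ∀ j → ∃ λ x → x ∈ LB j × x ∉Im f
    free-colour j = find (free j)
    g : Fin q → A
    g = proj₁ ∘ free-colour
    g∈ : ∀ j → g j ∈ LB j
    g∈ = proj₁ ∘ proj₂ ∘ free-colour
    g∉ : ∀ j → g j ∉Im f
    g∉ = proj₂ ∘ proj₂ ∘ free-colour

  -- Take h₂ at i′ and h₁ elsewhere: as h₂ i′ = h₁ i, the value h₁ i′ is no longer needed.
  patched-choice : {L : Fin (suc n) → List A} {h₁ h₂ : Fin (suc n) → A} →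
                   (∀ i → h₁ i ∈ L i) → (∀ i → h₂ i ∈ L i) → ∀ {i i′} → i′ ≢ i → h₂ i′ ≡ h₁ i →
                   ChoiceWithin L (h₁ ∘ punchIn i′)
  patched-choice {n = n} {L} {h₁} {h₂} h₁∈ h₂∈ {i} {i′} i′≢i h₂i′≡h₁i = f , f∈ , f∈Im
    where
    f : Fin (suc n) → A
    f t with t Fin.≟ i′
    ... | yes _ = h₂ i′
    ... | no  _ = h₁ t
    f∈ : ∀ t → f t ∈ L t
    f∈ t with t Fin.≟ i′
    ... | yes refl = h₂∈ t
    ... | no  _    = h₁∈ t
    f∈Im : ∀ t → f t ∈Im (h₁ ∘ punchIn i′)
    f∈Im t with t Fin.≟ i′
    ... | yes _   = ∈Im-punchIn i′ (i , sym h₂i′≡h₁i) i′≢i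
    ... | no t≢i′ = ∈Im-punchIn i′ (t , refl) (t≢i′ ∘ sym)

  module _ (_≟_ : DecidableEquality A) where

    open DecMembership _≟_ using (_∈?_)

    _∈Im?_ : (x : A) (h : Fin m → A) → Dec (x ∈Im h)
    x ∈Im? h = any? (λ t → h t ≟ x)

    missed-by-fewer : {xs : List A} → Unique xs → m < length xs → (h : Fin m → A) → Any (_∉Im h) xs
    missed-by-fewer uxs m<len h = ¬All⇒Any¬ (_∈Im? h) _ (¬covered-by-fewer uxs m<len h)

    ¬missed⇒covered : {xs : List A} {h : Fin m → A} → ¬ Any (_∉Im h) xs → All (_∈Im h) xs
    ¬missed⇒covered {xs = xs} {h} ¬missed = All.map (decidable-stable (_ ∈Im? h)) (¬Any⇒All¬ xs ¬missed)

    covered⇒∈ : {xs : List A} → Unique xs → length xs ≡ suc n → (h : Fin (suc n) → A) →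
                All (_∈Im h) xs → ∀ i → h i ∈ xs
    covered⇒∈ {xs = xs} uxs len h cov i with h i ∈? xs
    ... | yes hi∈xs = hi∈xs
    ... | no  hi∉xs =
      ⊥-elim (¬covered-by-fewer uxs (≤-reflexive (sym len)) (h ∘ punchIn i) (All.tabulate avoid))
      where
      avoid : ∀ {x} → x ∈ xs → x ∈Im (h ∘ punchIn i)
      avoid x∈xs with All.lookup cov x∈xs
      ... | t , ht≡x = ∈Im-punchIn i (t , ht≡x) λ { refl → hi∉xs (subst (_∈ xs) (sym ht≡x) x∈xs) }

    distinct-covers⇒repeat : {xs : List A} → Unique xs → length xs ≡ suc n → {h₁ h₂ : Fin (suc n) → A} →
                             All (_∈Im h₁) xs → All (_∈Im h₂) xs → ∀ {i} → h₁ i ≢ h₂ i →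
                             ∃ λ i′ → i′ ≢ i × h₂ i′ ≡ h₁ i
    distinct-covers⇒repeat uxs len {h₁} {h₂} cov₁ cov₂ {i} h₁i≢h₂i =
      let i′ , h₂i′≡h₁i = All.lookup cov₂ (covered⇒∈ uxs len h₁ cov₁ i)
      in i′ , (λ i′≡i → h₁i≢h₂i (trans (sym h₂i′≡h₁i) (cong h₂ i′≡i))) , h₂i′≡h₁i

    colouring-from-few-colours : {LA : Fin p → List A} {LB : Fin q → List A} → Uniform k LB → m < k →
                                 {h : Fin m → A} → ChoiceWithin LA h → BipartiteListColouring LA LB
    colouring-from-few-colours uB m<k {h} (f , f∈ , f∈Im) =
      colouring-avoiding f∈ λ j →
        Any.map narrow (missed-by-fewer (proj₁ (uB j)) (subst (_ <_) (sym (proj₂ (uB j))) m<k) h)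
      where
      narrow : ∀ {x} → x ∉Im h → x ∉Im f
      narrow x∉h (i , fi≡x) = let t , ht≡fi = f∈Im i in x∉h (t , trans ht≡fi fi≡x)

    colouring-small : {LA : Fin p → List A} {LB : Fin q → List A} → p < k →
                      Uniform k LA → Uniform k LB → BipartiteListColouring LA LB
    colouring-small {p} {k = suc k} {LA} p<k uA uB =
      colouring-from-few-colours uB p<k (first , (λ i → entry-∈ (LA i) (proj₂ (uA i)) zero) , λ i → i , refl)
      where
      first : Fin p → A
      first i = entry (LA i) (proj₂ (uA i)) zero

    colouring-tight : {LA : Fin (suc n) → List A} {LB : Fin q → List A} → q < suc n ^ suc n →
                      Uniform (suc n) LA → Uniform (suc n) LB → BipartiteListColouring LA LB
    colouring-tight {n} {q} {LA} {LB} q<kᵏ uA uB = by-cases (any? frees?)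
      where
      transversal : Fin (suc n ^ suc n) → Fin (suc n) → A
      transversal e i = entry (LA i) (proj₂ (uA i)) (finToFun e i)

      transversal-∈ : ∀ e i → transversal e i ∈ LA i
      transversal-∈ e i = entry-∈ (LA i) (proj₂ (uA i)) (finToFun e i)

      frees-at? : ∀ e j → Dec (Any (_∉Im (transversal e)) (LB j))
      frees-at? e j = Any.any? (λ x → ¬? (x ∈Im? (transversal e))) (LB j)

      Frees : Fin (suc n ^ suc n) → Set ℓ
      Frees e = ∀ j → Any (_∉Im (transversal e)) (LB j)

      frees? : ∀ e → Dec (Frees e)
      frees? e = all? (frees-at? e)

      blocker : ¬ ∃ Frees → ∀ e → ∃ λ j → All (_∈Im (transversal e)) (LB j)
      blocker ¬free e =
        let j , ¬missed = ¬∀⟶∃¬ q _ (frees-at? e) (¬free ∘ (e ,_)) in j , ¬missed⇒covered ¬missed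

      by-cases : Dec (∃ Frees) → BipartiteListColouring LA LB
      by-cases (yes (e , free)) = colouring-avoiding (transversal-∈ e) free
      by-cases (no ¬free) =
        let e₁ , e₂ , e₁<e₂ , same = pigeonhole q<kᵏ (proj₁ ∘ blocker ¬free)
            j , cov₁ = blocker ¬free e₁
            cov₂ = subst (λ j → All (_∈Im (transversal e₂)) (LB j)) (sym same) (proj₂ (blocker ¬free e₂))
            i , differ = finToFun-≢ (<⇒≢ e₁<e₂)
            i′ , i′≢i , repeat = distinct-covers⇒repeat (proj₁ (uB j)) (proj₂ (uB j)) cov₁ cov₂
                                   (differ ∘ entry-injective (proj₁ (uA i)) (proj₂ (uA i)))
        in colouring-from-few-colours uB ≤-refl
             (patched-choice (transversal-∈ e₁) (transversal-∈ e₂) i′≢i repeat)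

module Obstruction {k q : ℕ} (kᵏ≤q : k ^ k ≤ q) where

  colour : Fin k → Fin k → ℕ
  colour i d = toℕ (combine i d)

  code : Fin q → Fin (k ^ k)
  code j with toℕ j <? k ^ k
  ... | yes j<kᵏ = fromℕ< j<kᵏ
  ... | no  _    = funToFin {k} id

  code-inject≤ : ∀ e → code (inject≤ e kᵏ≤q) ≡ e
  code-inject≤ e with toℕ (inject≤ e kᵏ≤q) <? k ^ k
  ... | yes j<kᵏ = toℕ-injective (trans (toℕ-fromℕ< j<kᵏ) (toℕ-inject≤ e kᵏ≤q))
  ... | no  j≮kᵏ = ⊥-elim (j≮kᵏ (subst (_< k ^ k) (sym (toℕ-inject≤ e kᵏ≤q)) (toℕ<n e)))

  LA : Fin k → List ℕ
  LA i = map (colour i) (allFin k)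

  LB : Fin q → List ℕ
  LB j = map (λ i → colour i (finToFun (code j) i)) (allFin k)

  length-map-allFin : (g : Fin k → ℕ) → length (map g (allFin k)) ≡ k
  length-map-allFin g = trans (length-map g (allFin k)) (length-tabulate id)

  uniform-LA : Uniform k LA
  uniform-LA i = Unique.map⁺ (λ eq → combine-injectiveʳ i _ i _ (toℕ-injective eq)) (Unique.allFin⁺ k)
               , length-map-allFin (colour i)

  uniform-LB : Uniform k LB
  uniform-LB j = Unique.map⁺ (λ eq → combine-injectiveˡ _ _ _ _ (toℕ-injective eq)) (Unique.allFin⁺ k)
               , length-map-allFin _

  ¬colouring : ¬ BipartiteListColouring LA LB
  ¬colouring (f , g , f∈ , g∈ , f≢g) = f≢g i j (trans (f≡ i) (sym g≡))
    where
    picked : Fin k → Fin k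
    picked i = proj₁ (∈-map⁻ (colour i) (f∈ i))
    f≡ : ∀ i → f i ≡ colour i (picked i)
    f≡ i = proj₂ (proj₂ (∈-map⁻ (colour i) (f∈ i)))
    j : Fin q
    j = inject≤ (funToFin picked) kᵏ≤q
    code-j : ∀ i → finToFun (code j) i ≡ picked i
    code-j i = trans (cong (λ e → finToFun e i) (code-inject≤ (funToFin picked))) (finToFun-funToFin picked i)
    g∈LB : ∃ λ i → i ∈ allFin k × g j ≡ colour i (finToFun (code j) i)
    g∈LB = ∈-map⁻ _ (g∈ j)
    i : Fin k
    i = proj₁ g∈LB
    g≡ : g j ≡ colour i (picked i)
    g≡ = trans (proj₂ (proj₂ g∈LB)) (cong (colour i) (code-j i))

choosable-mono : {G : Graph} → m ≤ k → Choosable G m → Choosable G k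
choosable-mono {m} m≤k choose (L , uL) =
  let c , proper , c∈ = choose (take m ∘ L , uniform-take)
  in c , proper , λ x → Sublist.lookup (take-⊆ m (L x)) (c∈ x)
  where
  uniform-take : Uniform m (take m ∘ L)
  uniform-take x = Unique.take⁺ m (proj₁ (uL x))
                 , trans (length-take m (L x)) (trans (cong (m ⊓_) (proj₂ (uL x))) (m≤n⇒m⊓n≡m m≤k))

isListChromaticNumber : {G : Graph} → Choosable G (suc k) → ¬ Choosable G k → IsListChromaticNumber G (suc k)
isListChromaticNumber {k} {G} choose ¬choose = choose , least
  where
  least : ∀ j → Choosable G j → suc k ≤ j
  least j choose-j with j ≤? k
  ... | yes j≤k = ⊥-elim (¬choose (choosable-mono j≤k choose-j))
  ... | no  j≰k = ≰⇒> j≰k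

edge⇒2≤ : {G : Graph} {x y : Fin (V G)} → Adj G x y → Colourable G k → 2 ≤ k
edge⇒2≤ {zero}        {x = x} _ (c , _) with () ← c x
edge⇒2≤ {suc zero}    {x = x} {y} xy (c , proper) with c x in cx | c y in cy
... | zero | zero = ⊥-elim (proper x y xy (trans cx (sym cy)))
edge⇒2≤ {suc (suc k)} _ _ = s≤s (s≤s z≤n)

proper-[,] : {C : Set} (f : Fin p → C) (g : Fin q → C) → (∀ i j → f i ≢ g j) →
             ProperColouring (K 0 ∨G Kbip p q) ([ f , g ]′ ∘ splitAt p)
proper-[,] {p} f g f≢g x y = proper (splitAt p x) (splitAt p y)
  where
  proper : ∀ s t → joinAdj (λ _ _ → ⊥) (λ _ _ → ⊥) s t → [ f , g ]′ s ≢ [ f , g ]′ t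
  proper (inj₁ _) (inj₁ _) ()
  proper (inj₂ _) (inj₂ _) ()
  proper (inj₁ i) (inj₂ j) _ = f≢g i j
  proper (inj₂ j) (inj₁ i) _ = f≢g i j ∘ sym

adj-↑ˡ-↑ʳ : (i : Fin p) (j : Fin q) → Adj (K 0 ∨G Kbip p q) (i ↑ˡ q) (p ↑ʳ j)
adj-↑ˡ-↑ʳ {p} {q} i j =
  subst₂ (joinAdj (λ _ _ → ⊥) (λ _ _ → ⊥)) (sym (splitAt-↑ˡ p i q)) (sym (splitAt-↑ʳ p q j)) tt

isChromaticNumber-2 : 1 ≤ p → 1 ≤ q → IsChromaticNumber (K 0 ∨G Kbip p q) 2
isChromaticNumber-2 {suc p} {suc q} _ _ =
  (_ , proper-[,] {suc p} {suc q} (λ _ → zero) (λ _ → suc zero) λ _ _ ())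
  , λ _ → edge⇒2≤ {x = zero ↑ˡ suc q} {suc p ↑ʳ zero} (adj-↑ˡ-↑ʳ {suc p} {suc q} zero zero)

BipartiteChoosable : ℕ → ℕ → ℕ → Set
BipartiteChoosable p q k =
  (LA : Fin p → List ℕ) (LB : Fin q → List ℕ) → Uniform k LA → Uniform k LB → BipartiteListColouring LA LB

bipartite⇒choosable : BipartiteChoosable p q k → Choosable (K 0 ∨G Kbip p q) k
bipartite⇒choosable {p} {q} choose (L , uL) =
  let f , g , f∈ , g∈ , f≢g = choose (L ∘ (_↑ˡ q)) (L ∘ (p ↑ʳ_)) (uL ∘ (_↑ˡ q)) (uL ∘ (p ↑ʳ_))
      ∈L : ∀ s → [ f , g ]′ s ∈ L (join p q s)
      ∈L = [ f∈ , g∈ ]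
  in [ f , g ]′ ∘ splitAt p , proper-[,] f g f≢g ,
     λ x → subst (λ y → [ f , g ]′ (splitAt p x) ∈ L y) (join-splitAt p q x) (∈L (splitAt p x))

uniform-[,] : {A : Set ℓ} {LA : Fin p → List A} {LB : Fin q → List A} → Uniform k LA → Uniform k LB →
              Uniform k ([ LA , LB ]′ ∘ splitAt p)
uniform-[,] {p = p} uA uB x with splitAt p x
... | inj₁ i = uA i
... | inj₂ j = uB j

choosable⇒bipartite : Choosable (K 0 ∨G Kbip p q) k → BipartiteChoosable p q k
choosable⇒bipartite {p} {q} choose LA LB uA uB =
  let c , proper , c∈ = choose ([ LA , LB ]′ ∘ splitAt p , uniform-[,] uA uB)
  in c ∘ (_↑ˡ q) , c ∘ (p ↑ʳ_)
   , (λ i → subst (λ s → c (i ↑ˡ q) ∈ [ LA , LB ]′ s) (splitAt-↑ˡ p i q) (c∈ (i ↑ˡ q)))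
   , (λ j → subst (λ s → c (p ↑ʳ j) ∈ [ LA , LB ]′ s) (splitAt-↑ʳ p q j) (c∈ (p ↑ʳ j)))
   , λ i j → proper _ _ (adj-↑ˡ-↑ʳ i j)

choosable-small : p < k → Choosable (K 0 ∨G Kbip p q) k
choosable-small p<k = bipartite⇒choosable λ _ _ → colouring-small ℕ._≟_ p<k

choosable-tight : q < suc n ^ suc n → Choosable (K 0 ∨G Kbip (suc n) q) (suc n)
choosable-tight q<kᵏ = bipartite⇒choosable λ _ _ → colouring-tight ℕ._≟_ q<kᵏ

¬choosable-large : k ^ k ≤ q → ¬ Choosable (K 0 ∨G Kbip k q) k
¬choosable-large {k} kᵏ≤q choose = ¬colouring (choosable⇒bipartite choose LA LB uniform-LA uniform-LB)
  where open Obstruction {k} kᵏ≤q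

choosable⇒isTau0 : 1 ≤ p → 1 ≤ q → Choosable (K 0 ∨G Kbip p q) (2 + s) → IsTau s p q 0
choosable⇒isTau0 {p} {q} {s} 1≤p 1≤q choose = gap , λ _ _ → z≤n
  where
  gap : GapAtMost s 0 p q
  gap χ χℓ isχ isχℓ = ∸-mono (proj₂ isχℓ _ choose) (proj₂ (isChromaticNumber-2 1≤p 1≤q) χ (proj₁ isχ))

¬choosable⇒¬isTau0 : 1 ≤ q → ¬ Choosable (K 0 ∨G Kbip (2 + s) q) (2 + s) → ¬ IsTau s (2 + s) q 0
¬choosable⇒¬isTau0 {s = s} 1≤q ¬choose (gap , _) =
  n≮n s (gap 2 (3 + s) (isChromaticNumber-2 (s≤s z≤n) 1≤q)
             (isListChromaticNumber (choosable-small ≤-refl) ¬choose))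

isTau0⇔<kᵏ : 1 ≤ q → IsTau s (2 + s) q 0 ⇔ q < (2 + s) ^ (2 + s)
isTau0⇔<kᵏ 1≤q =
  mk⇔ (λ isTau0 → ≰⇒> λ kᵏ≤q → ¬choosable⇒¬isTau0 1≤q (¬choosable-large kᵏ≤q) isTau0)
      (λ q<kᵏ → choosable⇒isTau0 (s≤s z≤n) 1≤q (choosable-tight q<kᵏ))

lemma5 : (a b s : ℕ) → 1 ≤ a → a ≤ b →
    (a ≤ s + 1 → IsTau s a b 0) ×
    (a ≡ s + 2 → (IsTau s a b 0 ⇔ b < (s + 2) ^ (s + 2)))
lemma5 a b s 1≤a a≤b = small , critical
  where
  1≤b : 1 ≤ b
  1≤b = ≤-trans 1≤a a≤b

  small : a ≤ s + 1 → IsTau s a b 0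
  small a≤s+1 = choosable⇒isTau0 1≤a 1≤b (choosable-small (s≤s (≤-trans a≤s+1 (≤-reflexive (+-comm s 1)))))

  critical : a ≡ s + 2 → (IsTau s a b 0 ⇔ b < (s + 2) ^ (s + 2))
  critical a≡s+2 rewrite a≡s+2 | +-comm s 2 = isTau0⇔<kᵏ 1≤b
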